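{- The logic $\mathsf{S5}\Pi$ is incomplete with respect to the class of all full world frames: the formula $\exists q\,(q\wedge\forall p\,(p\to\Box(q\to p)))$ is valid on every full world frame but is not a theorem of $\mathsf{S5}\Pi$.
   Context: The language $\mathcal{L}\Pi$: $\varphi::=p\mid\neg\varphi\mid(\varphi\wedge\varphi)\mid\Box\varphi\mid\forall p\,\varphi$ with $p$ ranging over a countably infinite set of propositional variables; $\vee,\to,\leftrightarrow$ are defined classically from $\neg,\wedge$, $\Diamond=\neg\Box\neg$, $\exists p=\neg\forall p\neg$. $\mathsf{S5}\Pi$ is the set of formulas derivable from: all $\mathcal{L}\Pi$-instances of propositional tautologies, of $\Box(\varphi\to\psi)\to(\Box\varphi\to\Box\psi)$, $\Box\varphi\to\varphi$, $\Box\varphi\to\Box\Box\varphi$, $\neg\Box\varphi\to\Box\neg\Box\varphi$; $\forall p(\varphi\to\psi)\to(\forall p\varphi\to\forall p\psi)$; $\forall p\varphi\to\varphi^p_\psi$ whenever $\psi$ is substitutable for $p$ in $\varphi$ ($\varphi^p_\psi$: replacement of free occurrences of $p$ by $\psi$); $\varphi\to\forall p\varphi$ when $p$ is not free in $\varphi$; closed under modus ponens, necessitation (from $\varphi$ infer $\Box\varphi$) and universal generalization (from $\varphi$ infer $\forall p\varphi$). For a poset $(S,\sqsubseteq)$, $\mathcal{RO}(S,\sqsubseteq)$ is the set of $U\subseteq S$ with $U=\{x\mid\forall x'\sqsubseteq x\ \exists x''\sqsubseteq x': x''\in U\}$. A full possibility frame is $(S,\sqsubseteq,\mathcal{RO}(S,\sqsubseteq))$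 for a poset $(S,\sqsubseteq)$; a full world frame is one where $\sqsubseteq$ is the identity (so $\mathcal{RO}=\wp(S)$). A model on it is a valuation $\pi$ from variables to $\mathcal{RO}(S,\sqsubseteq)$; $x\Vdash p$ iff $x\in\pi(p)$; $x\Vdash\neg\varphi$ iff no $x'\sqsubseteq x$ has $x'\Vdash\varphi$; $\wedge$ pointwise; $x\Vdash\Box\varphi$ iff $y\Vdash\varphi$ for all $y\in S$; $x\Vdash\forall p\varphi$ iff $x\Vdash\varphi$ in every model on the same frame whose valuation differs from $\pi$ at most at $p$. A formula is valid on the frame if true at every point in every model on it. -}

module Defs where

open import Data.Nat using (ℕ; _≡ᵇ_)
open import Data.Bool using (Bool; true; false; not; _∧_; _∨_; if_then_else_)
open import Data.Product using (_×_; Σ)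
open import Data.Empty using (⊥)
open import Relation.Nullary using (¬_)
open import Relation.Binary.PropositionalEquality using (_≡_)
open import Level using (Level; suc)

Var : Set
Var = ℕ

data Form : Set where
  var  : Var → Form
  ~_   : Form → Form
  _&_  : Form → Form → Form
  □_   : Form → Form
  Π    : Var → Form → Form

infixr 6 _&_
infixr 4 _⇒_

_⇒_ : Form → Form → Form
φ ⇒ ψ = ~ (φ & ~ ψ)

_∨'_ : Form → Form → Form
φ ∨' ψ = ~ (~ φ & ~ ψ)

_⇔_ : Form → Form → Form
φ ⇔ ψ = (φ ⇒ ψ) & (ψ ⇒ φ)

◇_ : Form → Form
◇ φ = ~ □ ~ φ

Σ' : Var → Form → Form
Σ' p φ = ~ Π p (~ φ)

free : Var → Form → Bool
free p (var q)   = p ≡ᵇ q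
free p (~ φ)     = free p φ
free p (φ & ψ)   = free p φ ∨ free p ψ
free p (□ φ)     = free p φ
free p (Π q φ)   = not (p ≡ᵇ q) ∧ free p φ

sub : Form → Var → Form → Form
sub (var q) p ψ = if p ≡ᵇ q then ψ else var q
sub (~ φ) p ψ   = ~ sub φ p ψ
sub (φ & χ) p ψ = sub φ p ψ & sub χ p ψ
sub (□ φ) p ψ   = □ sub φ p ψ
sub (Π q φ) p ψ = if p ≡ᵇ q then Π q φ else Π q (sub φ p ψ)

-- ψ is substitutable for p in φ: no free occurrence of p in φ lies in
-- the scope of a quantifier Π q with q free in ψ.
substitutable : Form → Var → Form → Bool
substitutable ψ p (var q) = true
substitutable ψ p (~ φ)   = substitutable ψ p φ
substitutable ψ p (φ & χ) = substitutable ψ p φ ∧ substitutable ψ p χ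
substitutable ψ p (□ φ)   = substitutable ψ p φ
substitutable ψ p (Π q φ) =
  (p ≡ᵇ q) ∨ (not (free p φ) ∨ (not (free q ψ) ∧ substitutable ψ p φ))

IsTrue : Bool → Set
IsTrue b = b ≡ true

data PForm : Set where
  atom : ℕ → PForm
  neg  : PForm → PForm
  conj : PForm → PForm → PForm

evalP : (ℕ → Bool) → PForm → Bool
evalP v (atom n)   = v n
evalP v (neg a)    = not (evalP v a)
evalP v (conj a b) = evalP v a ∧ evalP v b

Tautology : PForm → Set
Tautology a = (v : ℕ → Bool) → IsTrue (evalP v a)

inst : (ℕ → Form) → PForm → Form
inst σ (atom n)   = σ n
inst σ (neg a)    = ~ inst σ a
inst σ (conj a b) = inst σ a & inst σ b

data S5Π⊢_ : Form → Set where
  taut : (a : PForm) → Tautology a → (σ : ℕ → Form) → S5Π⊢ inst σ a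
  axK  : (φ ψ : Form) → S5Π⊢ (□ (φ ⇒ ψ) ⇒ (□ φ ⇒ □ ψ))
  axT  : (φ : Form) → S5Π⊢ (□ φ ⇒ φ)
  ax4  : (φ : Form) → S5Π⊢ (□ φ ⇒ □ □ φ)
  ax5  : (φ : Form) → S5Π⊢ (~ □ φ ⇒ □ ~ □ φ)
  axΠK : (p : Var) (φ ψ : Form) → S5Π⊢ (Π p (φ ⇒ ψ) ⇒ (Π p φ ⇒ Π p ψ))
  axInst : (p : Var) (φ ψ : Form) → IsTrue (substitutable ψ p φ) →
           S5Π⊢ (Π p φ ⇒ sub φ p ψ)
  axVac : (p : Var) (φ : Form) → free p φ ≡ false → S5Π⊢ (φ ⇒ Π p φ)
  mp   : {φ ψ : Form} → S5Π⊢ (φ ⇒ ψ) → S5Π⊢ φ → S5Π⊢ ψ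
  nec  : {φ : Form} → S5Π⊢ φ → S5Π⊢ (□ φ)
  gen  : (p : Var) {φ : Form} → S5Π⊢ φ → S5Π⊢ (Π p φ)

-- Full world frames: a set S with identity order, so every subset is
-- regular open. Subsets are predicates S → Set.
Valuation : Set → Set₁
Valuation S = Var → S → Set

_[_↦_] : {S : Set} → Valuation S → Var → (S → Set) → Valuation S
(π [ p ↦ U ]) q = if p ≡ᵇ q then U else π q

sat : {S : Set} → Valuation S → S → Form → Set₁
sat π x (var p) = Level.Lift _ (π p x)
sat π x (~ φ)   = ¬ sat π x φ
sat π x (φ & ψ) = sat π x φ × sat π x ψ
sat {S} π x (□ φ) = (y : S) → sat π y φ
sat π x (Π p φ) = (U : _ → Set) → sat (π [ p ↦ U ]) x φ

ValidOnFullWorldFrame : Set → Form → Set₁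
ValidOnFullWorldFrame S φ = (π : Valuation S) (x : S) → sat π x φ

ValidOnAllFullWorldFrames : Form → Set₁
ValidOnAllFullWorldFrames φ = (S : Set) → ValidOnFullWorldFrame S φ

qVar pVar : Var
qVar = 0
pVar = 1

witnessFormula : Form
witnessFormula =
  Σ' qVar (var qVar & Π pVar (var pVar ⇒ □ (var qVar ⇒ var pVar)))

-- On a full world frame the singleton of the current world witnesses q.
-- For the non-derivability we give a semantics for S5Π in which no
-- proposition is an atom. Formulas are evaluated over the worlds {0,1}ᵏ,
-- and a propositional quantifier ranges over propositions on {0,1}ᵏ⁺¹,
-- every world w being refined into its two extensions 0w and 1w. The
-- semantics is invariant under surjections between world sets, which
-- makes vacuous quantification and instantiation sound across levels.
-- In the one-world model the formula fails: once q is quantified, the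
-- next quantifier refines the world again, and a proposition p true at
-- only one of the two refinements shows that q does not entail p.
module Submission where

open import Data.Bool using (Bool; true; false; not; _∧_; _∨_; if_then_else_)
  renaming (_≟_ to _≟ᵇ_)
open import Data.Bool.Properties
  using (∧-conicalˡ; ∧-conicalʳ; ∨-conicalˡ; ∨-conicalʳ; ∨-zeroʳ; ¬-not; not-injective; ⇔→≡; T-≡)
open import Data.Empty using (⊥)
open import Data.Nat using (ℕ; zero; suc; _≡ᵇ_)
open import Data.Nat.Properties using (≡ᵇ⇒≡; ≡⇒≡ᵇ)
open import Data.Product using (_×_; _,_; ∃-syntax)
open import Data.Sum using (inj₁; inj₂)
open import Data.Vec using (Vec; []; _∷_; head; tail)
open import Data.Vec.Properties using (≡-dec)
open import Function using (_∘_; const)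
open import Function.Bundles using (Equivalence; mk⇔)
open import Level using (lift; lower)
open import Relation.Nullary using (¬_; Dec; yes; no)
open import Relation.Nullary.Decidable using (map′; _×-dec_; _⊎-dec_)
open import Relation.Binary.PropositionalEquality
  using (_≡_; refl; sym; trans; cong; cong₂; subst; _≗_)

open import Defs

witnessFormula-valid : ValidOnAllFullWorldFrames witnessFormula
witnessFormula-valid S π x noWitness =
  noWitness (_≡ x) (lift refl , λ U (Ux , escapes) →
    escapes λ y (y≡x , ¬Uy) → ¬Uy (lift (subst U (sym (lower y≡x)) (lower Ux))))

implies-intro : ∀ {a b} → (a ≡ true → b ≡ true) → not (a ∧ not b) ≡ true
implies-intro {false}         _ = refl
implies-intro {true} {true}   _ = refl
implies-intro {true} {false} a⇒b = a⇒b refl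

implies-elim : ∀ {a b} → not (a ∧ not b) ≡ true → a ≡ true → b ≡ true
implies-elim {true} {true} _ _ = refl

∨-introʳ : ∀ a {b} → b ≡ true → a ∨ b ≡ true
∨-introʳ a refl = ∨-zeroʳ a

≡ᵇ-refl : ∀ n → (n ≡ᵇ n) ≡ true
≡ᵇ-refl n = Equivalence.to T-≡ (≡⇒≡ᵇ n n refl)

≡ᵇ-true : ∀ m n → (m ≡ᵇ n) ≡ true → m ≡ n
≡ᵇ-true m n e = ≡ᵇ⇒≡ m n (Equivalence.from T-≡ e)

≡ᵇ-sym : ∀ m n → (m ≡ᵇ n) ≡ (n ≡ᵇ m)
≡ᵇ-sym zero    zero    = refl
≡ᵇ-sym zero    (suc n) = refl
≡ᵇ-sym (suc m) zero    = refl
≡ᵇ-sym (suc m) (suc n) = ≡ᵇ-sym m n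

free-Π⁺ : ∀ {q p} φ → (p ≡ᵇ q) ≡ false → free q φ ≡ true → free q (Π p φ) ≡ true
free-Π⁺ {q} {p} φ p≢q q∈φ rewrite ≡ᵇ-sym q p | p≢q = q∈φ

free-bound : ∀ p q φ → (p ≡ᵇ q) ≡ true → free p (Π q φ) ≡ false
free-bound p q φ p≡q rewrite p≡q = refl

sub-not-free : ∀ φ p ψ → free p φ ≡ false → sub φ p ψ ≡ φ
sub-not-free (var q) p ψ p∉φ rewrite p∉φ = refl
sub-not-free (~ φ)   p ψ p∉φ = cong ~_ (sub-not-free φ p ψ p∉φ)
sub-not-free (φ & χ) p ψ p∉φ =
  cong₂ _&_ (sub-not-free φ p ψ (∨-conicalˡ _ _ p∉φ))
            (sub-not-free χ p ψ (∨-conicalʳ _ _ p∉φ))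
sub-not-free (□ φ)   p ψ p∉φ = cong □_ (sub-not-free φ p ψ p∉φ)
sub-not-free (Π q φ) p ψ p∉φ with p ≡ᵇ q
... | true  = refl
... | false = cong (Π q) (sub-not-free φ p ψ p∉φ)

-- Finite quantification over worlds and propositions

World : ℕ → Set
World = Vec Bool

Proposition : ℕ → Set
Proposition n = World n → Bool

Surjective : ∀ {n m} → (World n → World m) → Set
Surjective f = ∀ w → ∃[ u ] f u ≡ w

tail-surjective : ∀ {n} → Surjective (tail {n = n})
tail-surjective w = false ∷ w , refl

allWorlds : ∀ n → Proposition n → Bool
allWorlds zero    P = P []
allWorlds (suc n) P = allWorlds n (P ∘ (false ∷_)) ∧ allWorlds n (P ∘ (true ∷_))

allWorlds-elim : ∀ n {P} → allWorlds n P ≡ true → ∀ v → P v ≡ true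
allWorlds-elim zero    h []          = h
allWorlds-elim (suc n) h (false ∷ v) = allWorlds-elim n (∧-conicalˡ _ _ h) v
allWorlds-elim (suc n) h (true ∷ v)  = allWorlds-elim n (∧-conicalʳ _ _ h) v

allWorlds-intro : ∀ n {P} → (∀ v → P v ≡ true) → allWorlds n P ≡ true
allWorlds-intro zero    h = h []
allWorlds-intro (suc n) h = cong₂ _∧_ (allWorlds-intro n (h ∘ (false ∷_)))
                                      (allWorlds-intro n (h ∘ (true ∷_)))

allWorlds-cong : ∀ n {P Q} → P ≗ Q → allWorlds n P ≡ allWorlds n Q
allWorlds-cong zero    P≗Q = P≗Q []
allWorlds-cong (suc n) P≗Q = cong₂ _∧_ (allWorlds-cong n (P≗Q ∘ (false ∷_)))
                                       (allWorlds-cong n (P≗Q ∘ (true ∷_)))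

allWorlds-surjective : ∀ {n m} {f : World n → World m} → Surjective f →
                       (P : Proposition m) → allWorlds n (P ∘ f) ≡ allWorlds m P
allWorlds-surjective {n} {m} {f} f-onto P = ⇔→≡ (mk⇔
  (λ h → allWorlds-intro m λ w → let u , fu≡w = f-onto w in
    subst (λ w → P w ≡ true) fu≡w (allWorlds-elim n h u))
  (λ h → allWorlds-intro n λ u → allWorlds-elim m h (f u)))

any? : ∀ n {P : World n → Set} → (∀ v → Dec (P v)) → Dec (∃[ v ] P v)
any? zero    P? = map′ ([] ,_) (λ { ([] , p) → p }) (P? [])
any? (suc n) P? = map′
  (λ { (inj₁ (v , p)) → false ∷ v , p ; (inj₂ (v , p)) → true ∷ v , p })
  (λ { (false ∷ v , p) → inj₁ (v , p) ; (true ∷ v , p) → inj₂ (v , p) })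
  (any? n (P? ∘ (false ∷_)) ⊎-dec any? n (P? ∘ (true ∷_)))

branch : ∀ {n} → Proposition n → Proposition n → Proposition (suc n)
branch g h v = if head v then g (tail v) else h (tail v)

allProps : ∀ n → (Proposition n → Bool) → Bool
allProps zero    P = P (const false) ∧ P (const true)
allProps (suc n) P = allProps n λ g → allProps n λ h → P (branch g h)

Extensional : ∀ {n} → (Proposition n → Bool) → Set
Extensional P = ∀ {c c'} → c ≗ c' → P c ≡ P c'

allProps-intro : ∀ n {P} → (∀ c → P c ≡ true) → allProps n P ≡ true
allProps-intro zero    h = cong₂ _∧_ (h _) (h _)
allProps-intro (suc n) h = allProps-intro n λ _ → allProps-intro n λ _ → h _

allProps-cong : ∀ n {P Q} → (∀ c → P c ≡ Q c) → allProps n P ≡ allProps n Q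
allProps-cong zero    P≡Q = cong₂ _∧_ (P≡Q _) (P≡Q _)
allProps-cong (suc n) P≡Q = allProps-cong n λ _ → allProps-cong n λ _ → P≡Q _

branch-cong : ∀ {n} {g g' h h' : Proposition n} → g ≗ g' → h ≗ h' → branch g h ≗ branch g' h'
branch-cong g≗g' h≗h' (true ∷ w)  = g≗g' w
branch-cong g≗g' h≗h' (false ∷ w) = h≗h' w

allProps-elim : ∀ n {P} → Extensional P → allProps n P ≡ true → ∀ c → P c ≡ true
allProps-elim zero {P} ext h c = trans (ext λ { [] → refl }) (at-constant (c []))
  where
  at-constant : ∀ b → P (const b) ≡ true
  at-constant false = ∧-conicalˡ _ _ h
  at-constant true  = ∧-conicalʳ _ _ h
allProps-elim (suc n) {P} ext h c = trans (ext c-branches) (at-branch g h')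
  where
  g h' : Proposition n
  g  = c ∘ (true ∷_)
  h' = c ∘ (false ∷_)
  at-branch : ∀ g h' → P (branch g h') ≡ true
  at-branch g = allProps-elim n (λ h≗h' → ext (branch-cong {g = g} (λ _ → refl) h≗h'))
    (allProps-elim n (λ g≗g' → allProps-cong n λ h' → ext (branch-cong {h = h'} g≗g' λ _ → refl))
      h g)
  c-branches : c ≗ branch g h'
  c-branches (true ∷ w)  = refl
  c-branches (false ∷ w) = refl

-- The refinement semantics

Assignment : ℕ → Set
Assignment n = Var → Proposition n

_[_≔_] : ∀ {n} → Assignment n → Var → Proposition n → Assignment n
(ρ [ p ≔ c ]) q v = if p ≡ᵇ q then c v else ρ q v

_∘ᵃ_ : ∀ {n m} → Assignment m → (World n → World m) → Assignment n
(ρ ∘ᵃ f) q = ρ q ∘ f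

infixl 5 _[_≔_]
infixl 6 _∘ᵃ_

everyChild : ∀ {n} → Proposition (suc n) → Proposition n
everyChild P w = P (false ∷ w) ∧ P (true ∷ w)

eval : ∀ {k} → Assignment k → Form → Proposition k
eval ρ (var p) w = ρ p w
eval ρ (~ φ)   w = not (eval ρ φ w)
eval ρ (φ & ψ) w = eval ρ φ w ∧ eval ρ ψ w
eval {k} ρ (□ φ) _ = allWorlds k (eval ρ φ)
eval {k} ρ (Π p φ) w = allProps (suc k) λ c → everyChild (eval (ρ ∘ᵃ tail [ p ≔ c ]) φ) w

Π-cong : ∀ {k} {ρ ρ' : Assignment k} {p p' φ φ'} →
         (∀ c → eval (ρ ∘ᵃ tail [ p ≔ c ]) φ ≗ eval (ρ' ∘ᵃ tail [ p' ≔ c ]) φ') →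
         eval ρ (Π p φ) ≗ eval ρ' (Π p' φ')
Π-cong {k} h w = allProps-cong (suc k) λ c → cong₂ _∧_ (h c (false ∷ w)) (h c (true ∷ w))

update-agree : ∀ {k} p φ {ρ ρ' : Assignment k} {c c'} →
               (∀ q → free q (Π p φ) ≡ true → ρ q ≗ ρ' q) → c ≗ c' →
               ∀ q → free q φ ≡ true → (ρ [ p ≔ c ]) q ≗ (ρ' [ p ≔ c' ]) q
update-agree p φ ρ≗ρ' c≗c' q q∈φ v with p ≡ᵇ q in p≟q
... | true  = c≗c' v
... | false = ρ≗ρ' q (free-Π⁺ φ p≟q q∈φ) v

eval-agree : ∀ {k} φ {ρ ρ' : Assignment k} →
             (∀ q → free q φ ≡ true → ρ q ≗ ρ' q) → eval ρ φ ≗ eval ρ' φ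
eval-agree (var p) ρ≗ρ' = ρ≗ρ' p (≡ᵇ-refl p)
eval-agree (~ φ)   ρ≗ρ' w = cong not (eval-agree φ ρ≗ρ' w)
eval-agree (φ & ψ) ρ≗ρ' w =
  cong₂ _∧_ (eval-agree φ (λ q q∈φ → ρ≗ρ' q (cong (_∨ free q ψ) q∈φ)) w)
            (eval-agree ψ (λ q q∈ψ → ρ≗ρ' q (∨-introʳ (free q φ) q∈ψ)) w)
eval-agree {k} (□ φ) ρ≗ρ' _ = allWorlds-cong k (eval-agree φ ρ≗ρ')
eval-agree (Π p φ) {ρ} {ρ'} ρ≗ρ' =
  Π-cong {ρ = ρ} {ρ'} {p} {p} {φ} {φ} λ c →
    eval-agree φ (update-agree p φ (λ q q∈Πφ → ρ≗ρ' q q∈Πφ ∘ tail) λ _ → refl)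

eval-update-cong : ∀ {k} φ p (ρ : Assignment k) {c c'} → c ≗ c' →
                   eval (ρ [ p ≔ c ]) φ ≗ eval (ρ [ p ≔ c' ]) φ
eval-update-cong φ p ρ c≗c' = eval-agree φ (update-agree p φ (λ _ _ _ → refl) c≗c')

update-not-free : ∀ {k} φ {p} (ρ : Assignment k) c → free p φ ≡ false →
                  eval (ρ [ p ≔ c ]) φ ≗ eval ρ φ
update-not-free φ {p} ρ c p∉φ = eval-agree φ λ q q∈φ v → irrelevant q q∈φ (ρ q v) (c v)
  where
  irrelevant : ∀ q → free q φ ≡ true → ∀ a b → (if p ≡ᵇ q then b else a) ≡ a
  irrelevant q q∈φ a b with p ≡ᵇ q in p≟q
  ... | false = refl
  ... | true with ≡ᵇ-true p q p≟q
  ...   | refl with () ← trans (sym q∈φ) p∉φ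

update-comm : ∀ {k} p q (σ : Assignment k) {a a' c} → (p ≡ᵇ q) ≡ false → a ≗ a' →
              ∀ r → (σ [ q ≔ c ] [ p ≔ a ]) r ≗ (σ [ p ≔ a' ] [ q ≔ c ]) r
update-comm p q σ p≢q a≗a' r v with p ≡ᵇ r in p≟r | q ≡ᵇ r in q≟r
... | false | _     = refl
... | true  | false = a≗a' v
... | true  | true  with ≡ᵇ-true p r p≟r | ≡ᵇ-true q r q≟r
...   | refl | refl with () ← trans (sym (≡ᵇ-refl p)) p≢q

Π-intro : ∀ {k} (ρ : Assignment k) p φ w →
          (∀ c x → eval (ρ ∘ᵃ tail [ p ≔ c ]) φ (x ∷ w) ≡ true) → eval ρ (Π p φ) w ≡ true
Π-intro {k} ρ p φ w h = allProps-intro (suc k) λ c → cong₂ _∧_ (h c false) (h c true)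

Π-elim : ∀ {k} (ρ : Assignment k) p φ w → eval ρ (Π p φ) w ≡ true →
         ∀ c x → eval (ρ ∘ᵃ tail [ p ≔ c ]) φ (x ∷ w) ≡ true
Π-elim {k} ρ p φ w h c x =
  at-child x {eval (ρ ∘ᵃ tail [ p ≔ c ]) φ} (allProps-elim (suc k) extensional h c)
  where
  extensional : Extensional λ c → everyChild (eval (ρ ∘ᵃ tail [ p ≔ c ]) φ) w
  extensional c≗c' = cong₂ _∧_ (eval-update-cong φ p (ρ ∘ᵃ tail) c≗c' (false ∷ w))
                               (eval-update-cong φ p (ρ ∘ᵃ tail) c≗c' (true ∷ w))
  at-child : ∀ x {P : Proposition (suc k)} → everyChild P w ≡ true → P (x ∷ w) ≡ true
  at-child false {P} = ∧-conicalˡ (P (false ∷ w)) _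
  at-child true  {P} = ∧-conicalʳ (P (false ∷ w)) _

-- Invariance under surjections

extendWith : ∀ {n m} → (Bool → World n → Bool) → (World n → World m) → World (suc n) → World (suc m)
extendWith bit f v = bit (head v) (tail v) ∷ f (tail v)

extend-surjective : ∀ {n m} {f : World n → World m} → Surjective f →
                    Surjective (extendWith (λ x _ → x) f)
extend-surjective f-onto (y ∷ w) = let u , fu≡w = f-onto w in y ∷ u , cong (y ∷_) fu≡w

-- Every proposition on the refinement of the domain of a surjection f is
-- the pullback of a proposition on the refinement of its codomain, along
-- a surjective extension of f.
record Lifting {n m} (f : World n → World m) (c : Proposition (suc n)) : Set where
  field
    bit        : Bool → World n → Bool
    prop       : Proposition (suc m)
    surjective : Surjective (extendWith bit f)
    factorises : ∀ v → prop (extendWith bit f v) ≡ c v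

module _ {n m} {f : World n → World m} (f-onto : Surjective f) (c : Proposition (suc n)) where

  data FiberView (w : World m) : Set where
    constant : (y : Bool) → (∀ v → f (tail v) ≡ w → c v ≡ y) → FiberView w
    mixed    : (∀ y → ∃[ v ] f (tail v) ≡ w × c v ≡ y) → FiberView w

  hitsFiber : ∀ w y v → Dec (f (tail v) ≡ w × c v ≡ y)
  hitsFiber w y v = ≡-dec _≟ᵇ_ (f (tail v)) w ×-dec (c v ≟ᵇ y)

  fiberView : ∀ w → FiberView w
  fiberView w with any? (suc n) (hitsFiber w false) | any? (suc n) (hitsFiber w true)
  ... | no noFalse | _ = constant true λ v fv≡w → ¬-not λ cv → noFalse (v , fv≡w , cv)
  ... | yes _ | no noTrue = constant false λ v fv≡w → ¬-not λ cv → noTrue (v , fv≡w , cv)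
  ... | yes hitFalse | yes hitTrue = mixed λ { false → hitFalse ; true → hitTrue }

  -- On a fiber where c is constant the new bit is kept, elsewhere it is
  -- replaced by the value of c; this makes the extension onto.
  bitAt : ∀ {w} → FiberView w → Bool → Bool → Bool
  bitAt (constant _ _) x _  = x
  bitAt (mixed _)      _ cx = cx

  propAt : ∀ {w} → FiberView w → Bool → Bool
  propAt (constant y _) _ = y
  propAt (mixed _)      y = y

  lifting : Lifting f c
  lifting = record { bit = bit ; prop = prop ; surjective = onto ; factorises = factorises }
    where
    bit : Bool → World n → Bool
    bit x u = bitAt (fiberView (f u)) x (c (x ∷ u))

    prop : Proposition (suc m)
    prop (y ∷ w) = propAt (fiberView w) y

    factorises : ∀ v → prop (extendWith bit f v) ≡ c v
    factorises (x ∷ u) with fiberView (f u)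
    ... | constant y c≡y = sym (c≡y (x ∷ u) refl)
    ... | mixed _        = refl

    onto : Surjective (extendWith bit f)
    onto (y ∷ w) with fiberView w in view≡
    ... | constant _ _ with f-onto w
    ...   | u , refl = y ∷ u , cong (λ view → bitAt view y (c (y ∷ u)) ∷ f u) view≡
    onto (y ∷ w) | mixed hit with hit y
    ...   | x ∷ u , refl , cx≡y =
            x ∷ u , cong₂ _∷_ (trans (cong (λ view → bitAt view x (c (x ∷ u))) view≡) cx≡y) refl

eval-reindex : ∀ φ {n m} {f : World n → World m} → Surjective f →
               (ρ : Assignment m) → eval (ρ ∘ᵃ f) φ ≗ eval ρ φ ∘ f
eval-reindex (var p) f-onto ρ u = refl
eval-reindex (~ φ)   f-onto ρ u = cong not (eval-reindex φ f-onto ρ u)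
eval-reindex (φ & ψ) f-onto ρ u = cong₂ _∧_ (eval-reindex φ f-onto ρ u) (eval-reindex ψ f-onto ρ u)
eval-reindex (□ φ) {n} f-onto ρ u =
  trans (allWorlds-cong n (eval-reindex φ f-onto ρ)) (allWorlds-surjective f-onto (eval ρ φ))
eval-reindex (Π p φ) {n} {m} {f} f-onto ρ u = ⇔→≡ (mk⇔ pushforward pullback)
  where
  pushforward : eval (ρ ∘ᵃ f) (Π p φ) u ≡ true → eval ρ (Π p φ) (f u) ≡ true
  pushforward h = Π-intro ρ p φ (f u) λ b x →
    trans (sym (eval-reindex φ (extend-surjective f-onto) (ρ ∘ᵃ tail [ p ≔ b ]) (x ∷ u)))
          (Π-elim (ρ ∘ᵃ f) p φ u h (b ∘ extendWith (λ x _ → x) f) x)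

  pullback : eval ρ (Π p φ) (f u) ≡ true → eval (ρ ∘ᵃ f) (Π p φ) u ≡ true
  pullback h = Π-intro (ρ ∘ᵃ f) p φ u λ c x →
    let open Lifting (lifting f-onto c) in
    trans (eval-update-cong φ p (ρ ∘ᵃ f ∘ᵃ tail) (sym ∘ factorises) (x ∷ u))
      (trans (eval-reindex φ surjective (ρ ∘ᵃ tail [ p ≔ prop ]) (x ∷ u))
             (Π-elim ρ p φ (f u) h prop (bit x u)))

eval-tail : ∀ {k} φ (ρ : Assignment k) → eval (ρ ∘ᵃ tail) φ ≗ eval ρ φ ∘ tail
eval-tail φ = eval-reindex φ tail-surjective

-- Soundness

eval-sub : ∀ {k} φ p ψ (ρ : Assignment k) → substitutable ψ p φ ≡ true →
           eval ρ (sub φ p ψ) ≗ eval (ρ [ p ≔ eval ρ ψ ]) φ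
eval-sub (var q) p ψ ρ _ w with p ≡ᵇ q
... | true  = refl
... | false = refl
eval-sub (~ φ)   p ψ ρ ok w = cong not (eval-sub φ p ψ ρ ok w)
eval-sub (φ & χ) p ψ ρ ok w =
  cong₂ _∧_ (eval-sub φ p ψ ρ (∧-conicalˡ _ _ ok) w) (eval-sub χ p ψ ρ (∧-conicalʳ _ _ ok) w)
eval-sub {k} (□ φ) p ψ ρ ok _ = allWorlds-cong k (eval-sub φ p ψ ρ ok)
eval-sub (Π q φ) p ψ ρ ok w with p ≡ᵇ q in p≟q
... | true = sym (update-not-free (Π q φ) ρ (eval ρ ψ) (free-bound p q φ p≟q) w)
... | false with free p φ in p-free
...   | false rewrite sub-not-free φ p ψ p-free =
        sym (update-not-free (Π q φ) ρ (eval ρ ψ) p∉Πφ w)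
  where
  p∉Πφ : free p (Π q φ) ≡ false
  p∉Πφ rewrite p≟q = p-free
...   | true = Π-cong {ρ = ρ} {ρ [ p ≔ eval ρ ψ ]} {q} {q} {sub φ p ψ} {φ} (λ c v →
        trans (eval-sub φ p ψ (ρ ∘ᵃ tail [ q ≔ c ]) (∧-conicalʳ _ _ ok) v)
              (eval-agree φ (λ r _ → update-comm p q (ρ ∘ᵃ tail) p≟q (ψ-lifted c) r) v)) w
  where
  ψ-lifted : ∀ c → eval (ρ ∘ᵃ tail [ q ≔ c ]) ψ ≗ eval ρ ψ ∘ tail
  ψ-lifted c v =
    trans (update-not-free ψ (ρ ∘ᵃ tail) c (not-injective (∧-conicalˡ _ _ ok)) v) (eval-tail ψ ρ v)

Valid : Form → Set
Valid φ = ∀ k (ρ : Assignment k) w → eval ρ φ w ≡ true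

eval-inst : ∀ {k} (ρ : Assignment k) σ a w → eval ρ (inst σ a) w ≡ evalP (λ n → eval ρ (σ n) w) a
eval-inst ρ σ (atom n)   w = refl
eval-inst ρ σ (neg a)    w = cong not (eval-inst ρ σ a w)
eval-inst ρ σ (conj a b) w = cong₂ _∧_ (eval-inst ρ σ a w) (eval-inst ρ σ b w)

sound : ∀ {φ} → S5Π⊢ φ → Valid φ
sound (taut a tautology σ) k ρ w = trans (eval-inst ρ σ a w) (tautology _)
sound (axK φ ψ) k ρ w = implies-intro λ □φ⇒ψ → implies-intro λ □φ → allWorlds-intro k λ v →
  implies-elim (allWorlds-elim k □φ⇒ψ v) (allWorlds-elim k □φ v)
sound (axT φ) k ρ w = implies-intro λ □φ → allWorlds-elim k □φ w
sound (ax4 φ) k ρ w = implies-intro λ □φ → allWorlds-intro k λ _ → □φ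
sound (ax5 φ) k ρ w = implies-intro λ ◇~φ → allWorlds-intro k λ _ → ◇~φ
sound (axΠK p φ ψ) k ρ w = implies-intro λ Πφ⇒ψ → implies-intro λ Πφ → Π-intro ρ p ψ w λ c x →
  implies-elim (Π-elim ρ p (φ ⇒ ψ) w Πφ⇒ψ c x) (Π-elim ρ p φ w Πφ c x)
sound (axInst p φ ψ ok) k ρ w = implies-intro λ Πφ →
  trans (eval-sub φ p ψ ρ ok w)
    (trans (sym (eval-tail φ (ρ [ p ≔ eval ρ ψ ]) (false ∷ w)))
           (Π-elim ρ p φ w Πφ (eval ρ ψ ∘ tail) false))
sound (axVac p φ p∉φ) k ρ w = implies-intro λ φ-holds → Π-intro ρ p φ w λ c x →
  trans (update-not-free φ (ρ ∘ᵃ tail) c p∉φ (x ∷ w)) (trans (eval-tail φ ρ (x ∷ w)) φ-holds)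
sound (mp ⊢φ⇒ψ ⊢φ) k ρ w = implies-elim (sound ⊢φ⇒ψ k ρ w) (sound ⊢φ k ρ w)
sound (nec ⊢φ) k ρ w = allWorlds-intro k λ v → sound ⊢φ k ρ v
sound (gen p {φ} ⊢φ) k ρ w = Π-intro ρ p φ w λ c x → sound ⊢φ (suc k) (ρ ∘ᵃ tail [ p ≔ c ]) (x ∷ w)

witnessFormula-fails : eval {0} (λ _ _ → false) witnessFormula [] ≡ false
witnessFormula-fails = refl

proposition5p1p4 : ValidOnAllFullWorldFrames witnessFormula × ¬ (S5Π⊢ witnessFormula)
proposition5p1p4 =
  witnessFormula-valid ,
  λ ⊢witness → true≢false (trans (sym (sound ⊢witness 0 (λ _ _ → false) [])) witnessFormula-fails)
  where
  true≢false : true ≡ false → ⊥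
  true≢false ()
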